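{- Let $m\geq 1$ and $s\geq 3$ be integers. Let $E^-_m(s)$ denote the number of partitions with distinct parts that are simultaneously $s$-cores and $(ms-1)$-cores, and for $k\geq 1$ let $E^+_m(k)$ denote the number of partitions with distinct parts that are simultaneously $k$-cores and $(mk+1)$-cores. Then $$E^-_m(s)=E^+_m(s-1)+(m-1)\,E^+_m(s-2).$$
   Context: For a box of the Young diagram of a partition, its hook length is the number of boxes in the same row weakly to its right plus the number in the same column strictly below. A partition is an $a$-core if none of its hook lengths equals $a$. The empty partition counts as a core with distinct parts. -}

module Defs where

open import Data.Nat using (ℕ; zero; suc; _+_; _∸_; _<_; _<?_)
open import Data.List using (List; []; _∷_; length; filter)
open import Data.List.Relation.Unary.All using (All)
open import Data.List.Relation.Unary.Linked using (Linked)
open import Data.List.Relation.Unary.Unique.Propositional using (Unique)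
open import Data.List.Membership.Propositional using (_∈_)
open import Data.Product using (Σ; _×_)
open import Relation.Binary.PropositionalEquality using (_≡_; _≢_)
open import Data.Nat using (_>_)

-- A partition is a list of its parts (row lengths), largest first.
-- A partition with distinct parts: parts are positive and strictly decreasing.
DistinctPartition : List ℕ → Set
DistinctPartition λs = All (0 <_) λs × Linked _>_ λs

-- i-th part (0-indexed), 0 beyond the length
part : List ℕ → ℕ → ℕ
part []       _       = 0
part (x ∷ _)  zero    = x
part (_ ∷ xs) (suc i) = part xs i

colLen : List ℕ → ℕ → ℕ
colLen λs j = length (filter (j <?_) λs)

-- hook length of box (i , j) (row i, column j, 0-indexed):
-- boxes weakly to the right in row i, plus boxes strictly below in column j
hook : List ℕ → ℕ → ℕ → ℕ
hook λs i j = (part λs i ∸ j) + (colLen λs j ∸ suc i)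

IsCore : ℕ → List ℕ → Set
IsCore a λs = ∀ i j → j < part λs i → hook λs i j ≢ a

DistinctCore : ℕ → ℕ → List ℕ → Set
DistinctCore s t λs = DistinctPartition λs × IsCore s λs × IsCore t λs

-- "the set of μ satisfying P is finite with exactly n elements":
-- a duplicate-free list enumerates exactly the μ with P μ, and has length n
HasCount : (List ℕ → Set) → ℕ → Set
HasCount P n =
  Σ (List (List ℕ)) (λ xs →
    Unique xs × (∀ μ → (μ ∈ xs → P μ) × (P μ → μ ∈ xs)) × length xs ≡ n)

-- A partition with distinct parts is determined by its β-set, the hook lengths of its first
-- column; the β-sets that arise are those with no entry 0 and no two consecutive entries, and
-- the partition is a t-core exactly when its β-set is closed under x ↦ x ∸ t. Put a β-set
-- closed under s on an abacus with s runners: runner 0 is empty, every other runner carries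
-- an initial segment of beads, and no two adjacent runners are both occupied. For t = m s ± 1
-- closure under t only bounds the bead counts: a bead at r + m s would force r ∓ 1 next to r,
-- so every runner carries at most m beads, and for t = m s − 1 the bead s − 1 + (m − 1) s = t
-- would force 0, so runner s − 1 carries at most m − 1. Conversely, within these bounds every
-- bead lies below t. Hence E⁺_m(k) counts the words of length k − 1 over {0, …, m} without two
-- adjacent nonzero letters, E⁻_m(s) counts those of length s − 1 whose first letter (the count
-- of runner s − 1) is at most m − 1, and splitting on the first letter gives the recurrence.
module Submission where

open import Defs
open import Data.Nat using (ℕ; _+_; _*_; _∸_; _≤_)
open import Data.Product using (Σ; _×_)
open import Relation.Binary.PropositionalEquality using (_≡_)

open import Data.Nat using (zero; suc; _<_; _>_; _<?_; _≤?_; z≤n; s≤s)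
open import Data.Nat.Properties
open import Data.Nat.DivMod using (_%_; _/_; m≡m%n+[m/n]*n; [m+kn]%n≡m%n; m<n⇒m%n≡m; m%n<n)
open import Data.List
  using (List; []; _∷_; length; filter; map; _++_; applyUpTo; downFrom; cartesianProductWith)
open import Data.List.Properties
  using (filter-accept; filter-reject; length-map; length-++; length-applyUpTo;
         ∷-injective; ∷-injectiveʳ)
open import Data.List.Membership.Propositional using (_∈_; _∉_)
open import Data.List.Membership.DecPropositional _≟_ using (_∈?_)
open import Data.List.Membership.Propositional.Properties
  using (∈-++⁻; ∈-++⁺ˡ; ∈-++⁺ʳ; ∈-map⁺; ∈-map⁻; ∈-applyUpTo⁺; ∈-applyUpTo⁻;
         ∈-cartesianProductWith⁺; ∈-cartesianProductWith⁻; ∈-filter⁺; ∈-filter⁻; ∈-downFrom⁺)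
open import Data.List.Relation.Binary.Disjoint.Propositional using (Disjoint)
open import Data.List.Relation.Binary.Subset.Propositional using (_⊆_)
open import Data.List.Relation.Unary.All as All using (All; []; _∷_)
open import Data.List.Relation.Unary.All.Properties using (map⁺)
open import Data.List.Relation.Unary.Any using (here; there)
import Data.List.Relation.Unary.AllPairs as AllPairs
open import Data.List.Relation.Unary.Linked as Linked using (Linked; []; [-]; _∷_)
open import Data.List.Relation.Unary.Linked.Properties using (Linked⇒All; applyDownFrom⁺₂; filter⁺)
open import Data.List.Relation.Unary.Unique.Propositional using (Unique)
import Data.List.Relation.Unary.Unique.Propositional.Properties as Unique
open import Data.Product using (_,_; proj₁; proj₂; ∃-syntax)
open import Data.Product.Function.NonDependent.Propositional using (_×-⇔_)
open import Data.Sum using (_⊎_; inj₁; inj₂)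
open import Data.Empty using (⊥; ⊥-elim)
open import Function.Base using (_∘_; id)
open import Function.Bundles using (_⇔_; mk⇔; Equivalence)
import Function.Properties.Equivalence as ⇔
open import Function.Related.TypeIsomorphisms using (¬-cong-⇔)
open import Relation.Nullary using (¬_; yes; no)
open import Relation.Unary using (Decidable)
open import Relation.Binary.PropositionalEquality
  using (_≢_; refl; sym; trans; cong; cong₂; subst; subst₂; module ≡-Reasoning)

open Equivalence using (to; from)

private
  variable
    A C D : Set
    P : ℕ → Set
    a b h i j k l m n o q r t v x y z E N : ℕ
    μ ν B c c′ xs ys : List ℕ

∸-telescope : j ≤ b → b ≤ a → a ∸ j ≡ (a ∸ b) + (b ∸ j)
∸-telescope {j} {b} {a} j≤b b≤a = begin
  a ∸ j             ≡⟨ cong (_∸ j) (m∸n+n≡m b≤a) ⟨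
  (a ∸ b) + b ∸ j   ≡⟨ +-∸-assoc (a ∸ b) j≤b ⟩
  (a ∸ b) + (b ∸ j) ∎
  where open ≡-Reasoning

+-suc-∸ : E < h → E + suc (h ∸ suc E) ≡ h
+-suc-∸ {E} {h} E<h = trans (+-suc E (h ∸ suc E)) (m+[n∸m]≡n E<h)

+-suc-cancelˡ : E + suc h + x ≡ E + suc N → h + x ≡ N
+-suc-cancelˡ {E} {h} {x} eq =
  suc-injective (+-cancelˡ-≡ E _ _ (trans (sym (+-assoc E (suc h) x)) eq))

[m+[1+k]n]∸n≡m+kn : ∀ m k n → m + suc k * n ∸ n ≡ m + k * n
[m+[1+k]n]∸n≡m+kn m k n =
  trans (+-∸-assoc m (m≤m+n n (k * n))) (cong (m +_) (m+n∸m≡n n (k * n)))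

m<n⇒k<o⇒m+kn<on : m < n → k < o → m + k * n < o * n
m<n⇒k<o⇒m+kn<on {m} {n} {k} m<n k<o = ≤-trans (+-monoˡ-≤ (k * n) m<n) (*-monoˡ-≤ n k<o)

≤-from-< : (∀ {q} → q < a → q < b) → a ≤ b
≤-from-< {zero}  _     = z≤n
≤-from-< {suc a} a<⇒b< = a<⇒b< ≤-refl

DownClosed : (ℕ → Set) → Set
DownClosed P = ∀ q → P (suc q) → P q

DownClosed-≤ : DownClosed P → P q → r ≤ q → P r
DownClosed-≤ {q = zero}      _      Pq z≤n = Pq
DownClosed-≤ {q = suc q} {r} closed Pq r≤1+q with m≤n⇒m<n∨m≡n r≤1+q
... | inj₁ r<1+q = DownClosed-≤ closed (closed q Pq) (≤-pred r<1+q)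
... | inj₂ refl  = Pq

leadingCount : Decidable P → ℕ → ℕ
leadingCount P? zero    = 0
leadingCount P? (suc n) with P? 0
... | yes _ = suc (leadingCount (P? ∘ suc) n)
... | no  _ = 0

leadingCount≤ : (P? : Decidable P) → ∀ n → leadingCount P? n ≤ n
leadingCount≤ P? zero    = z≤n
leadingCount≤ P? (suc n) with P? 0
... | yes _ = s≤s (leadingCount≤ (P? ∘ suc) n)
... | no  _ = z≤n

leadingCount-spec : (P? : Decidable P) → DownClosed P → (∀ q → P q → q < n) →
                    ∀ q → P q ⇔ q < leadingCount P? n
leadingCount-spec {n = zero} P? _ bounded q =
  mk⇔ (λ Pq → ⊥-elim (<⇒≱ (bounded q Pq) z≤n)) (λ ())
leadingCount-spec {P = P} {n = suc n} P? closed bounded q with P? 0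
... | no ¬P0 = mk⇔ (λ Pq → ⊥-elim (¬P0 (DownClosed-≤ {P = P} closed Pq z≤n))) (λ ())
... | yes P0 with q
...   | zero  = mk⇔ (λ _ → s≤s z≤n) (λ _ → P0)
...   | suc q = mk⇔ (s≤s ∘ to shifted) (from shifted ∘ ≤-pred)
  where
  shifted : P (suc q) ⇔ q < leadingCount (P? ∘ suc) n
  shifted = leadingCount-spec (P? ∘ suc) (closed ∘ suc) (λ q → ≤-pred ∘ bounded (suc q)) q

head-bounds-tail : Linked _>_ (a ∷ μ) → All (_< a) μ
head-bounds-tail [-]          = []
head-bounds-tail (b<a ∷ tail) = Linked⇒All (λ p q → <-trans q p) b<a tail

head-max : Linked _>_ (x ∷ xs) → y ∈ x ∷ xs → y ≤ x
head-max _    (here refl)  = ≤-refl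
head-max decr (there y∈xs) = <⇒≤ (All.lookup (head-bounds-tail decr) y∈xs)

decreasing-ext : ∀ xs ys → Linked _>_ xs → Linked _>_ ys → xs ⊆ ys → ys ⊆ xs → xs ≡ ys
decreasing-ext []       []       _  _  _     _     = refl
decreasing-ext []       (y ∷ _)  _  _  _     ys⊆xs with () ← ys⊆xs (here refl)
decreasing-ext (x ∷ _)  []       _  _  xs⊆ys _     with () ← xs⊆ys (here refl)
decreasing-ext (x ∷ xs) (y ∷ ys) dx dy xs⊆ys ys⊆xs =
  cong₂ _∷_ x≡y (decreasing-ext xs ys (Linked.tail dx) (Linked.tail dy)
                                (shrink dx x≡y xs⊆ys) (shrink dy (sym x≡y) ys⊆xs))
  where
  x≡y : x ≡ y
  x≡y = ≤-antisym (head-max dy (xs⊆ys (here refl))) (head-max dx (ys⊆xs (here refl)))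
  shrink : ∀ {u v us vs} → Linked _>_ (u ∷ us) → u ≡ v → u ∷ us ⊆ v ∷ vs → us ⊆ vs
  shrink du u≡v ⊆ z∈us with ⊆ (there z∈us)
  ... | here z≡v   = ⊥-elim (<⇒≢ (All.lookup (head-bounds-tail du) z∈us) (trans z≡v (sym u≡v)))
  ... | there z∈vs = z∈vs

Unique-map⁺ : ∀ (f : A → C) {xs} → (∀ {x y} → x ∈ xs → y ∈ xs → f x ≡ f y → x ≡ y) →
              Unique xs → Unique (map f xs)
Unique-map⁺ f {[]}     _   _                     = AllPairs.[]
Unique-map⁺ f {x ∷ xs} inj (x∉xs AllPairs.∷ xs!) =
  map⁺ (All.tabulate (λ y∈xs fx≡fy → All.lookup x∉xs y∈xs (inj (here refl) (there y∈xs) fx≡fy)))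
  AllPairs.∷ Unique-map⁺ f (λ p q → inj (there p) (there q)) xs!

length-cartesianProductWith : ∀ (f : A → C → D) xs ys →
  length (cartesianProductWith f xs ys) ≡ length xs * length ys
length-cartesianProductWith f []       ys = refl
length-cartesianProductWith f (x ∷ xs) ys = begin
  length (map (f x) ys ++ cartesianProductWith f xs ys)
    ≡⟨ length-++ (map (f x) ys) ⟩
  length (map (f x) ys) + length (cartesianProductWith f xs ys)
    ≡⟨ cong₂ _+_ (length-map (f x) ys) (length-cartesianProductWith f xs ys) ⟩
  length ys + length xs * length ys ∎
  where open ≡-Reasoning

part-beyond : length c ≤ i → part c i ≡ 0
part-beyond {[]}            _       = refl
part-beyond {_ ∷ c} {suc i} (s≤s l) = part-beyond {c} l

part-ext : ∀ xs ys → length xs ≡ length ys → (∀ i → part xs i ≡ part ys i) → xs ≡ ys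
part-ext []       []       _   _     = refl
part-ext (x ∷ xs) (y ∷ ys) len parts =
  cong₂ _∷_ (parts 0) (part-ext xs ys (suc-injective len) (parts ∘ suc))

part-applyUpTo : ∀ (f : ℕ → ℕ) → i < n → part (applyUpTo f n) i ≡ f i
part-applyUpTo {zero}  {suc n} f _       = refl
part-applyUpTo {suc i} {suc n} f (s≤s l) = part-applyUpTo (f ∘ suc) l

part≤ : All (_< a) μ → ∀ i → part μ i ≤ a
part≤ []        _       = z≤n
part≤ (c<a ∷ _) zero    = <⇒≤ c<a
part≤ (_ ∷ μ<a) (suc i) = part≤ μ<a i

-- β-sets

-- beta μ lists the first-column hook lengths: in a ∷ μ the first box has arm a and leg length μ.
beta : List ℕ → List ℕ
beta []      = []
beta (a ∷ μ) = a + length μ ∷ beta μ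

unbeta : List ℕ → List ℕ
unbeta []      = []
unbeta (b ∷ B) = b ∸ length B ∷ unbeta B

length-beta : ∀ μ → length (beta μ) ≡ length μ
length-beta []      = refl
length-beta (a ∷ μ) = cong suc (length-beta μ)

length-unbeta : ∀ B → length (unbeta B) ≡ length B
length-unbeta []      = refl
length-unbeta (b ∷ B) = cong suc (length-unbeta B)

unbeta-beta : ∀ μ → unbeta (beta μ) ≡ μ
unbeta-beta []      = refl
unbeta-beta (a ∷ μ) =
  cong₂ _∷_ (trans (cong (a + length μ ∸_) (length-beta μ)) (m+n∸n≡m a (length μ)))
            (unbeta-beta μ)

beta-bound : All (_≤ a) μ → All (_< a + length μ) (beta μ)
beta-bound             []          = []
beta-bound {a} {_ ∷ μ} (c≤a ∷ μ≤a) =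
  ≤-<-trans (+-monoˡ-≤ (length μ) c≤a) a+l<a+1+l
  ∷ All.map (λ p → <-trans p a+l<a+1+l) (beta-bound μ≤a)
  where
  a+l<a+1+l : a + length μ < a + suc (length μ)
  a+l<a+1+l = +-monoʳ-< a (n<1+n (length μ))

Gap : ℕ → ℕ → Set
Gap x y = suc y < x

Gap-trans : Gap x y → Gap y z → Gap x z
Gap-trans {x} {y} x≫y y≫z = <-trans y≫z (<-trans (n<1+n y) x≫y)

Gap⇒> : Gap x y → x > y
Gap⇒> = <⇒≤

Sparse : List ℕ → Set
Sparse B = Linked Gap B × All (0 <_) B

Sparse-tail : Sparse (b ∷ B) → Sparse B
Sparse-tail (gaps , _ ∷ pos) = Linked.tail gaps , pos

length<head : Sparse (b ∷ B) → length B < b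
length<head ([-]        , 0<b ∷ _) = 0<b
length<head (c≪b ∷ gaps , _ ∷ pos) = <-trans (s≤s (length<head (gaps , pos))) c≪b

beta-unbeta : ∀ B → Sparse B → beta (unbeta B) ≡ B
beta-unbeta []      _  = refl
beta-unbeta (b ∷ B) sp =
  cong₂ _∷_ (trans (cong (b ∸ length B +_) (length-unbeta B)) (m∸n+n≡m (<⇒≤ (length<head sp))))
            (beta-unbeta B (Sparse-tail sp))

distinct⇒sparse : DistinctPartition μ → Sparse (beta μ)
distinct⇒sparse (pos , decr) = gaps decr , positive pos
  where
  gaps : Linked _>_ μ → Linked Gap (beta μ)
  gaps []                         = []
  gaps [-]                        = [-]
  gaps {a ∷ a′ ∷ μ} (a′<a ∷ decr) =
    ≤-trans (≤-reflexive (cong suc (sym (+-suc a′ (length μ))))) (+-monoˡ-< (suc (length μ)) a′<a)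
    ∷ gaps decr
  positive : All (0 <_) μ → All (0 <_) (beta μ)
  positive []          = []
  positive (0<a ∷ pos) = ≤-trans 0<a (m≤m+n _ _) ∷ positive pos

sparse⇒distinct : Sparse B → DistinctPartition (unbeta B)
sparse⇒distinct sp = positive sp , decreasing sp
  where
  positive : Sparse B → All (0 <_) (unbeta B)
  positive {[]}    _  = []
  positive {b ∷ B} sp = m<n⇒0<n∸m (length<head sp) ∷ positive (Sparse-tail sp)
  decreasing : Sparse B → Linked _>_ (unbeta B)
  decreasing {[]}        _                = []
  decreasing {b ∷ []}    _                = [-]
  decreasing {b ∷ c ∷ B} sp@(c≪b ∷ _ , _) =
    ≤-trans (≤-reflexive (sym (+-∸-assoc 1 (<⇒≤ (length<head (Sparse-tail sp))))))
            (∸-monoˡ-≤ (suc (length B)) c≪b)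
    ∷ decreasing (Sparse-tail sp)

no-successor : Linked Gap B → x ∈ B → suc x ∉ B
no-successor {_ ∷ B} _            (here refl) (here 1+x≡x)   = 1+n≢n 1+x≡x
no-successor {_ ∷ B} (x≫y ∷ gaps) (here refl) (there 1+x∈B) =
  <⇒≱ (All.lookup (Linked⇒All Gap-trans x≫y gaps) 1+x∈B) (≤-trans (n≤1+n _) (n≤1+n _))
no-successor {_ ∷ B} (y≫x ∷ gaps) (there x∈B) (here refl)    =
  <⇒≱ (All.lookup (Linked⇒All Gap-trans y≫x gaps) x∈B) ≤-refl
no-successor {_ ∷ B} gaps         (there x∈B) (there 1+x∈B) =
  no-successor (Linked.tail gaps) x∈B 1+x∈B

gaps-from-no-successor : Linked _>_ xs → (∀ {x} → x ∈ xs → suc x ∉ xs) → Linked Gap xs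
gaps-from-no-successor []           _      = []
gaps-from-no-successor [-]          _      = [-]
gaps-from-no-successor (y<x ∷ decr) noSucc with m≤n⇒m<n∨m≡n y<x
... | inj₁ 1+y<x = 1+y<x ∷ gaps-from-no-successor decr (λ p q → noSucc (there p) (there q))
... | inj₂ refl  = ⊥-elim (noSucc (there (here refl)) (here refl))

-- Hooks in the first row

colLen-∷-< : ∀ μ → j < a → colLen (a ∷ μ) j ≡ suc (colLen μ j)
colLen-∷-< μ j<a = cong length (filter-accept (_ <?_) j<a)

colLen-≡0 : All (_≤ j) μ → colLen μ j ≡ 0
colLen-≡0             []          = refl
colLen-≡0 {μ = _ ∷ μ} (a≤j ∷ μ≤j) =
  trans (cong length (filter-reject (_ <?_) (≤⇒≯ a≤j))) (colLen-≡0 μ≤j)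

FirstRowHook : ℕ → List ℕ → ℕ → Set
FirstRowHook a μ h = ∃[ j ] j < a × (a ∸ j) + colLen μ j ≡ h

-- For N = a + length μ and B = beta μ, the first-row hooks of a ∷ μ are exactly the distances
-- from N down to the numbers missing from B.
GapDistance : ℕ → List ℕ → ℕ → Set
GapDistance N B h = 1 ≤ h × ∃[ x ] h + x ≡ N × x ∉ B

gapDistance-∷ : GapDistance N B h → GapDistance (E + suc N) (N ∷ B) (E + suc h)
gapDistance-∷ {N} {B} {h} {E} (1≤h , x , h+x≡N , x∉B) =
  ≤-trans (s≤s z≤n) (m≤n+m (suc h) E) , x , shifted , x∉N∷B
  where
  shifted : E + suc h + x ≡ E + suc N
  shifted = begin
    E + suc h + x   ≡⟨ +-assoc E (suc h) x ⟩
    E + suc (h + x) ≡⟨ cong (λ n → E + suc n) h+x≡N ⟩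
    E + suc N       ∎
    where open ≡-Reasoning
  x∉N∷B : x ∉ N ∷ B
  x∉N∷B (here x≡N)  =
    <-irrefl refl (≤-trans (+-monoˡ-≤ x 1≤h) (≤-reflexive (trans h+x≡N (sym x≡N))))
  x∉N∷B (there x∈B) = x∉B x∈B

gapDistance-∷⁻ : GapDistance (E + suc N) (N ∷ B) (E + suc h) → GapDistance N B h
gapDistance-∷⁻ {h = zero}  (_ , x , eq , x∉N∷B) = ⊥-elim (x∉N∷B (here (+-suc-cancelˡ eq)))
gapDistance-∷⁻ {h = suc _} (_ , x , eq , x∉N∷B) =
  s≤s z≤n , x , +-suc-cancelˡ eq , x∉N∷B ∘ there

betaHead-shift : b ≤ a → a + suc l ≡ (a ∸ b) + suc (b + l)
betaHead-shift {b} {a} {l} b≤a = begin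
  a + suc l             ≡⟨ cong (_+ suc l) (m∸n+n≡m b≤a) ⟨
  (a ∸ b) + b + suc l   ≡⟨ +-assoc (a ∸ b) b (suc l) ⟩
  (a ∸ b) + (b + suc l) ≡⟨ cong ((a ∸ b) +_) (+-suc b l) ⟩
  (a ∸ b) + suc (b + l) ∎
  where open ≡-Reasoning

firstRowHook-shift : ∀ ν → j < b → b < a →
  (a ∸ j) + colLen (b ∷ ν) j ≡ (a ∸ b) + suc ((b ∸ j) + colLen ν j)
firstRowHook-shift {j} {b} {a} ν j<b b<a = begin
  (a ∸ j) + colLen (b ∷ ν) j
    ≡⟨ cong₂ _+_ (∸-telescope (<⇒≤ j<b) (<⇒≤ b<a)) (colLen-∷-< ν j<b) ⟩
  (a ∸ b) + (b ∸ j) + suc (colLen ν j)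
    ≡⟨ +-assoc (a ∸ b) (b ∸ j) _ ⟩
  (a ∸ b) + ((b ∸ j) + suc (colLen ν j))
    ≡⟨ cong ((a ∸ b) +_) (+-suc (b ∸ j) (colLen ν j)) ⟩
  (a ∸ b) + suc ((b ∸ j) + colLen ν j) ∎
  where open ≡-Reasoning

armHook⇒gapDistance : j < a → All (_≤ j) μ →
  GapDistance (a + length μ) (beta μ) ((a ∸ j) + colLen μ j)
armHook⇒gapDistance {j} {a} {μ} j<a μ≤j rewrite colLen-≡0 μ≤j =
  ≤-trans (m<n⇒0<n∸m j<a) (m≤m+n _ 0) , j + length μ , distance , beyond
  where
  distance : (a ∸ j) + 0 + (j + length μ) ≡ a + length μ
  distance = begin
    (a ∸ j) + 0 + (j + length μ) ≡⟨ cong (_+ (j + length μ)) (+-identityʳ (a ∸ j)) ⟩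
    (a ∸ j) + (j + length μ)     ≡⟨ +-assoc (a ∸ j) j (length μ) ⟨
    (a ∸ j) + j + length μ       ≡⟨ cong (_+ length μ) (m∸n+n≡m (<⇒≤ j<a)) ⟩
    a + length μ                 ∎
    where open ≡-Reasoning
  beyond : j + length μ ∉ beta μ
  beyond p = <-irrefl refl (All.lookup (beta-bound μ≤j) p)

gapDistance⇒armHook : 1 ≤ h → h ≤ a → All (_≤ a ∸ h) μ → FirstRowHook a μ h
gapDistance⇒armHook {h} {a} 1≤h h≤a μ≤a∸h =
  a ∸ h , ∸-monoʳ-< 1≤h h≤a ,
  trans (cong₂ _+_ (m∸[m∸n]≡n h≤a) (colLen-≡0 μ≤a∸h)) (+-identityʳ h)

firstRowHook⇒gapDistance : Linked _>_ (a ∷ μ) → FirstRowHook a μ h →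
                           GapDistance (a + length μ) (beta μ) h
firstRowHook⇒gapDistance {μ = []} _ (j , j<a , refl) = armHook⇒gapDistance j<a []
firstRowHook⇒gapDistance {a} {b ∷ ν} (b<a ∷ decr) (j , j<a , refl) with j <? b
... | no j≮b =
  armHook⇒gapDistance j<a
    (b≤j ∷ All.map (λ c<b → ≤-trans (<⇒≤ c<b) b≤j) (head-bounds-tail decr))
  where b≤j = ≮⇒≥ j≮b
... | yes j<b =
  subst₂ (λ N h → GapDistance N (beta (b ∷ ν)) h)
    (sym (betaHead-shift (<⇒≤ b<a))) (sym (firstRowHook-shift ν j<b b<a))
    (gapDistance-∷ (firstRowHook⇒gapDistance decr (j , j<b , refl)))

gapDistance⇒firstRowHook : Linked _>_ (a ∷ μ) → GapDistance (a + length μ) (beta μ) h →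
                           FirstRowHook a μ h
gapDistance⇒firstRowHook {a} {[]} {h} _ (1≤h , x , h+x≡a+0 , _) =
  gapDistance⇒armHook 1≤h (≤-trans (m≤m+n h x) (≤-reflexive (trans h+x≡a+0 (+-identityʳ a)))) []
gapDistance⇒firstRowHook {a} {b ∷ ν} {h} (b<a ∷ decr) gap with h ≤? a ∸ b
... | yes h≤a∸b =
  gapDistance⇒armHook (proj₁ gap) (≤-trans h≤a∸b (m∸n≤m a b))
    (b≤a∸h ∷ All.map (λ c<b → ≤-trans (<⇒≤ c<b) b≤a∸h) (head-bounds-tail decr))
  where
  b≤a∸h = m+n≤o⇒m≤o∸n b (≤-trans (+-monoʳ-≤ b h≤a∸b) (≤-reflexive (m+[n∸m]≡n (<⇒≤ b<a))))
... | no h≰a∸b with gapDistance⇒firstRowHook decr (gapDistance-∷⁻ shifted)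
  where
  shifted : GapDistance ((a ∸ b) + suc (b + length ν)) (beta (b ∷ ν))
                        ((a ∸ b) + suc (h ∸ suc (a ∸ b)))
  shifted = subst₂ (λ N h → GapDistance N (beta (b ∷ ν)) h)
              (betaHead-shift (<⇒≤ b<a)) (sym (+-suc-∸ (≰⇒> h≰a∸b))) gap
... | j , j<b , hook≡ = j , <-trans j<b b<a ,
  trans (firstRowHook-shift ν j<b b<a)
        (trans (cong (λ k → (a ∸ b) + suc k) hook≡) (+-suc-∸ (≰⇒> h≰a∸b)))

firstRowHook⇔gapDistance : Linked _>_ (a ∷ μ) →
  FirstRowHook a μ h ⇔ GapDistance (a + length μ) (beta μ) h
firstRowHook⇔gapDistance decr = mk⇔ (firstRowHook⇒gapDistance decr) (gapDistance⇒firstRowHook decr)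

-- Cores as closed β-sets

hook-∷-zero : ∀ μ → j < a → hook (a ∷ μ) 0 j ≡ (a ∸ j) + colLen μ j
hook-∷-zero {j} {a} μ j<a = cong (λ c → (a ∸ j) + (c ∸ 1)) (colLen-∷-< μ j<a)

hook-∷-suc : ∀ μ i → j < a → hook (a ∷ μ) (suc i) j ≡ hook μ i j
hook-∷-suc {j} {a} μ i j<a = cong (λ c → (part μ i ∸ j) + (c ∸ suc (suc i))) (colLen-∷-< μ j<a)

IsCore-∷ : Linked _>_ (a ∷ μ) → IsCore t (a ∷ μ) ⇔ (IsCore t μ × ¬ FirstRowHook a μ t)
IsCore-∷ {a} {μ} {t} decr = mk⇔ split join
  where
  below : ∀ {i j} → j < part μ i → j < a
  below {i} j<μᵢ = <-≤-trans j<μᵢ (part≤ (head-bounds-tail decr) i)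
  split : IsCore t (a ∷ μ) → IsCore t μ × ¬ FirstRowHook a μ t
  split core = (λ i j j<μᵢ ≡t → core (suc i) j j<μᵢ (trans (hook-∷-suc μ i (below j<μᵢ)) ≡t))
             , (λ (j , j<a , ≡t) → core 0 j j<a (trans (hook-∷-zero μ j<a) ≡t))
  join : IsCore t μ × ¬ FirstRowHook a μ t → IsCore t (a ∷ μ)
  join (_ , noHook) zero    j j<a  ≡t = noHook (j , j<a , trans (sym (hook-∷-zero μ j<a)) ≡t)
  join (core , _)   (suc i) j j<μᵢ ≡t =
    core i j j<μᵢ (trans (sym (hook-∷-suc μ i (below j<μᵢ))) ≡t)

Closed : ℕ → List ℕ → Set
Closed t B = ∀ {x} → x ∈ B → t ≤ x → x ∸ t ∈ B

Closed-below : (∀ {x} → x ∈ B → x < t) → Closed t B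
Closed-below below x∈B t≤x = ⊥-elim (<⇒≱ (below x∈B) t≤x)

Closed-descend : Closed n B → ∀ q → r + q * n ∈ B → r ∈ B
Closed-descend {B = B} {r} _ zero r∈B = subst (_∈ B) (+-identityʳ r) r∈B
Closed-descend {n} {B} {r} closed (suc q) x∈B =
  Closed-descend closed q
    (subst (_∈ B) ([m+[1+k]n]∸n≡m+kn r q n) (closed x∈B (≤-trans (m≤m+n n (q * n)) (m≤n+m _ r))))

Closed-∷ : 1 ≤ t → All (_< N) B → Closed t (N ∷ B) ⇔ (Closed t B × (t ≤ N → N ∸ t ∈ B))
Closed-∷ {t} {N} {B} 1≤t B<N = mk⇔ split join
  where
  split : Closed t (N ∷ B) → Closed t B × (t ≤ N → N ∸ t ∈ B)
  split closed = tail , head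
    where
    tail : Closed t B
    tail x∈B t≤x with closed (there x∈B) t≤x
    ... | here x∸t≡N  =
      ⊥-elim (<⇒≱ (All.lookup B<N x∈B) (≤-trans (≤-reflexive (sym x∸t≡N)) (m∸n≤m _ t)))
    ... | there x∸t∈B = x∸t∈B
    head : t ≤ N → N ∸ t ∈ B
    head t≤N with closed (here refl) t≤N
    ... | here N∸t≡N  = ⊥-elim (<⇒≢ (∸-monoʳ-< 1≤t t≤N) N∸t≡N)
    ... | there N∸t∈B = N∸t∈B
  join : Closed t B × (t ≤ N → N ∸ t ∈ B) → Closed t (N ∷ B)
  join (_ , head) (here refl) t≤x = there (head t≤x)
  join (tail , _) (there x∈B) t≤x = there (tail x∈B t≤x)

¬GapDistance⇔ : 1 ≤ t → (¬ GapDistance N B t) ⇔ (t ≤ N → N ∸ t ∈ B)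
¬GapDistance⇔ {t} {N} {B} 1≤t = mk⇔ filled noGap
  where
  filled : ¬ GapDistance N B t → t ≤ N → N ∸ t ∈ B
  filled ¬gap t≤N with N ∸ t ∈? B
  ... | yes N∸t∈B = N∸t∈B
  ... | no  N∸t∉B = ⊥-elim (¬gap (1≤t , N ∸ t , m+[n∸m]≡n t≤N , N∸t∉B))
  noGap : (t ≤ N → N ∸ t ∈ B) → ¬ GapDistance N B t
  noGap fill (_ , x , t+x≡N , x∉B) =
    x∉B (subst (_∈ B) (trans (cong (_∸ t) (sym t+x≡N)) (m+n∸m≡n t x))
                       (fill (≤-trans (m≤m+n t x) (≤-reflexive t+x≡N))))

IsCore⇔Closed : 1 ≤ t → Linked _>_ μ → IsCore t μ ⇔ Closed t (beta μ)
IsCore⇔Closed {μ = []}    _   _    = mk⇔ (λ _ ()) (λ _ _ _ ())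
IsCore⇔Closed {μ = a ∷ μ} 1≤t decr =
  ⇔.trans (IsCore-∷ decr)
    (⇔.trans (IsCore⇔Closed 1≤t (Linked.tail decr)
               ×-⇔ ⇔.trans (¬-cong-⇔ (firstRowHook⇔gapDistance decr)) (¬GapDistance⇔ 1≤t))
             (⇔.sym (Closed-∷ 1≤t (beta-bound (All.map <⇒≤ (head-bounds-tail decr))))))

-- Words of runner counts

module Profiles (m : ℕ) where

  record Profile (b n : ℕ) (c : List ℕ) : Set where
    field
      length≡  : length c ≡ n
      bounded  : ∀ i → part c i ≤ m
      head≤    : part c 0 ≤ b
      isolated : ∀ i → part c i ≡ 0 ⊎ part c (suc i) ≡ 0

  profiles : ℕ → ℕ → List (List ℕ)
  profiles b zero    = [] ∷ []
  profiles b (suc n) =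
    map (0 ∷_) (profiles m n) ++ cartesianProductWith _∷_ (applyUpTo suc b) (profiles 0 n)

  length-profiles : ∀ b n →
    length (profiles b (suc n)) ≡ length (profiles m n) + b * length (profiles 0 n)
  length-profiles b n = begin
    length (zeros ++ positives)
      ≡⟨ length-++ zeros ⟩
    length zeros + length positives
      ≡⟨ cong₂ _+_ (length-map (0 ∷_) (profiles m n))
                   (length-cartesianProductWith _∷_ (applyUpTo suc b) (profiles 0 n)) ⟩
    length (profiles m n) + length (applyUpTo suc b) * length (profiles 0 n)
      ≡⟨ cong (λ k → length (profiles m n) + k * length (profiles 0 n)) (length-applyUpTo suc b) ⟩
    length (profiles m n) + b * length (profiles 0 n) ∎
    where
    open ≡-Reasoning
    zeros     = map (0 ∷_) (profiles m n)
    positives = cartesianProductWith _∷_ (applyUpTo suc b) (profiles 0 n)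

  length-profiles-recurrence : ∀ b n →
    length (profiles b (suc (suc n))) ≡ length (profiles m (suc n)) + b * length (profiles m n)
  length-profiles-recurrence b n =
    trans (length-profiles b (suc n))
          (cong (λ k → length (profiles m (suc n)) + b * k) (trans (length-profiles 0 n) (+-identityʳ _)))

  profiles-unique : ∀ b n → Unique (profiles b n)
  profiles-unique b zero    = [] AllPairs.∷ AllPairs.[]
  profiles-unique b (suc n) =
    Unique.++⁺ (Unique.map⁺ ∷-injectiveʳ (profiles-unique m n))
               (Unique.cartesianProductWith⁺ _∷_ ∷-injective
                  (Unique.applyUpTo⁺₁ suc b (λ i<j _ → <⇒≢ i<j ∘ suc-injective))
                  (profiles-unique 0 n))
               zeros∉positives
    where
    zeros∉positives :
      Disjoint (map (0 ∷_) (profiles m n)) (cartesianProductWith _∷_ (applyUpTo suc b) (profiles 0 n))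
    zeros∉positives (p , q)
      with _ , _ , refl ← ∈-map⁻ (0 ∷_) p
      with _ , _ , v∈ , _ , eq ← ∈-cartesianProductWith⁻ _∷_ (applyUpTo suc b) (profiles 0 n) q
      with _ , _ , refl ← ∈-applyUpTo⁻ suc v∈
      with () ← eq

  Profile-0∷ : Profile m n c → Profile b (suc n) (0 ∷ c)
  Profile-0∷ p = record
    { length≡  = cong suc length≡
    ; bounded  = λ { zero → z≤n ; (suc i) → bounded i }
    ; head≤    = z≤n
    ; isolated = λ { zero → inj₁ refl ; (suc i) → isolated i }
    }
    where open Profile p

  Profile-positive∷ : b ≤ m → v ≤ b → Profile 0 n c → Profile b (suc n) (v ∷ c)
  Profile-positive∷ b≤m v≤b p = record
    { length≡  = cong suc length≡
    ; bounded  = λ { zero → ≤-trans v≤b b≤m ; (suc i) → bounded i }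
    ; head≤    = v≤b
    ; isolated = λ { zero → inj₂ (n≤0⇒n≡0 head≤) ; (suc i) → isolated i }
    }
    where open Profile p

  Profile-0∷⁻ : Profile b (suc n) (0 ∷ c) → Profile m n c
  Profile-0∷⁻ p = record
    { length≡  = suc-injective length≡
    ; bounded  = bounded ∘ suc
    ; head≤    = bounded 1
    ; isolated = isolated ∘ suc
    }
    where open Profile p

  Profile-positive∷⁻ : Profile b (suc n) (suc v ∷ c) → Profile 0 n c
  Profile-positive∷⁻ {c = c} p = record
    { length≡  = suc-injective length≡
    ; bounded  = bounded ∘ suc
    ; head≤    = head≤0
    ; isolated = isolated ∘ suc
    }
    where
    open Profile p
    head≤0 : part c 0 ≤ 0
    head≤0 with isolated 0
    ... | inj₂ c₀≡0 = ≤-reflexive c₀≡0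

  ∈profiles⁻ : b ≤ m → c ∈ profiles b n → Profile b n c
  ∈profiles⁻ {n = zero} _ (here refl) =
    record { length≡ = refl ; bounded = λ _ → z≤n ; head≤ = z≤n ; isolated = λ _ → inj₁ refl }
  ∈profiles⁻ {b} {n = suc n} b≤m c∈ with ∈-++⁻ (map (0 ∷_) (profiles m n)) c∈
  ... | inj₁ c∈zeros
    with _ , c′∈ , refl ← ∈-map⁻ (0 ∷_) c∈zeros
    = Profile-0∷ (∈profiles⁻ ≤-refl c′∈)
  ... | inj₂ c∈positives
    with _ , _ , v∈ , c′∈ , refl ←
           ∈-cartesianProductWith⁻ _∷_ (applyUpTo suc b) (profiles 0 n) c∈positives
    with _ , i<b , refl ← ∈-applyUpTo⁻ suc v∈
    = Profile-positive∷ b≤m i<b (∈profiles⁻ z≤n c′∈)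

  ∈profiles⁺ : Profile b n c → c ∈ profiles b n
  ∈profiles⁺ {n = zero}  {c = []}        _ = here refl
  ∈profiles⁺ {n = suc n} {c = []}        p with () ← Profile.length≡ p
  ∈profiles⁺ {n = zero}  {c = _ ∷ _}     p with () ← Profile.length≡ p
  ∈profiles⁺ {n = suc n} {c = zero ∷ c}  p =
    ∈-++⁺ˡ (∈-map⁺ (0 ∷_) (∈profiles⁺ (Profile-0∷⁻ p)))
  ∈profiles⁺ {n = suc n} {c = suc v ∷ c} p =
    ∈-++⁺ʳ (map (0 ∷_) (profiles m n))
      (∈-cartesianProductWith⁺ _∷_ (∈-applyUpTo⁺ suc (Profile.head≤ p))
                                   (∈profiles⁺ (Profile-positive∷⁻ p)))

-- The abacus

module Abacus (s′ m : ℕ) where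

  open Profiles m

  s : ℕ
  s = suc s′

  data Position : ℕ → Set where
    position : ∀ r q → r < s → Position (r + q * s)

  position-of : ∀ x → Position x
  position-of x =
    subst Position (sym (m≡m%n+[m/n]*n x s)) (position (x % s) (x / s) (m%n<n x s))

  position-% : ∀ q → r < s → (r + q * s) % s ≡ r
  position-% {r} q r<s = trans ([m+kn]%n≡m%n r q s) (m<n⇒m%n≡m r<s)

  position-/ : ∀ q → r < s → (r + q * s) / s ≡ q
  position-/ {r} q r<s = sym (*-cancelʳ-≡ q ((r + q * s) / s) s (+-cancelˡ-≡ r _ _ (begin
    r + q * s                             ≡⟨ m≡m%n+[m/n]*n (r + q * s) s ⟩
    (r + q * s) % s + (r + q * s) / s * s ≡⟨ cong (_+ (r + q * s) / s * s) (position-% q r<s) ⟩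
    r + (r + q * s) / s * s               ∎)))
    where open ≡-Reasoning

  -- A profile c lists the bead counts of the runners s′, s′ ∸ 1, …, 1; runner 0 sits at
  -- index s′, beyond the end of c, so it is always empty.
  runnerCount : List ℕ → ℕ → ℕ
  runnerCount c r = part c (s′ ∸ r)

  Bead : List ℕ → ℕ → Set
  Bead c x = x / s < runnerCount c (x % s)

  Bead? : ∀ c → Decidable (Bead c)
  Bead? c x = x / s <? runnerCount c (x % s)

  Bead-position : ∀ c q → r < s → Bead c (r + q * s) ⇔ q < runnerCount c r
  Bead-position c q r<s =
    mk⇔ (subst₂ (λ q r → q < runnerCount c r) (position-/ q r<s) (position-% q r<s))
        (subst₂ (λ q r → q < runnerCount c r) (sym (position-/ q r<s)) (sym (position-% q r<s)))

  beads : List ℕ → List ℕ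
  beads c = filter (Bead? c) (downFrom (m * s))

  beads-decreasing : ∀ c → Linked _>_ (beads c)
  beads-decreasing c =
    filter⁺ (Bead? c) (λ p q → <-trans q p) (applyDownFrom⁺₂ id (m * s) (λ _ → ≤-refl))

  module _ {b c} (p : Profile b s′ c) where

    open Profile p

    runnerCount-zero : runnerCount c 0 ≡ 0
    runnerCount-zero = part-beyond {c} (≤-reflexive length≡)

    Bead⇒< : Bead c x → x < m * s
    Bead⇒< {x} bead with position-of x
    ... | position r q r<s =
      m<n⇒k<o⇒m+kn<on r<s (<-≤-trans (to (Bead-position c q r<s) bead) (bounded _))

    ∈beads⇔ : x ∈ beads c ⇔ Bead c x
    ∈beads⇔ = mk⇔ (proj₂ ∘ ∈-filter⁻ (Bead? c) {xs = downFrom (m * s)})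
                  (λ bead → ∈-filter⁺ (Bead? c) (∈-downFrom⁺ (Bead⇒< bead)) bead)

    runnerCount⇔∈beads : ∀ q → r < s → q < runnerCount c r ⇔ r + q * s ∈ beads c
    runnerCount⇔∈beads q r<s = ⇔.trans (⇔.sym (Bead-position c q r<s)) (⇔.sym ∈beads⇔)

    adjacent-runners : r < s′ → runnerCount c r ≡ 0 ⊎ runnerCount c (suc r) ≡ 0
    adjacent-runners {r} r<s′ with isolated (s′ ∸ suc r)
    ... | inj₁ empty = inj₂ empty
    ... | inj₂ empty = inj₁ (trans (cong (part c) (+-∸-assoc 1 r<s′)) empty)

    beads-sparse : Sparse (beads c)
    beads-sparse =
      gaps-from-no-successor (beads-decreasing c)
        (λ p q → no-adjacent (to ∈beads⇔ p) (to ∈beads⇔ q)) ,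
      All.tabulate (positive ∘ to ∈beads⇔)
      where
      occupied : ∀ q → r < s → Bead c (r + q * s) → runnerCount c r ≡ 0 → ⊥
      occupied q r<s bead empty = n≮0 (subst (q <_) empty (to (Bead-position c q r<s) bead))
      positive : Bead c x → 0 < x
      positive {zero}  bead = ⊥-elim (occupied 0 (s≤s z≤n) bead runnerCount-zero)
      positive {suc x} _    = s≤s z≤n
      -- x + 1 lies on the next runner, or wraps around to runner 0 when x is on runner s′.
      no-adjacent : Bead c x → Bead c (suc x) → ⊥
      no-adjacent {x} bead bead′ with position-of x
      ... | position r q r<s with r <? s′
      ...   | yes r<s′ with adjacent-runners r<s′
      ...     | inj₁ empty = occupied q r<s bead empty
      ...     | inj₂ empty = occupied q (s≤s r<s′) bead′ empty
      no-adjacent bead bead′ | position r q r<s | no r≮s′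
        with ≤-antisym (≤-pred r<s) (≮⇒≥ r≮s′)
      ...     | refl = occupied (suc q) (s≤s z≤n) bead′ runnerCount-zero

    beads-closed : Closed s (beads c)
    beads-closed {x} x∈ s≤x with position-of x
    ... | position r zero    r<s = ⊥-elim (<⇒≱ r<s (≤-trans s≤x (≤-reflexive (+-identityʳ r))))
    ... | position r (suc q) r<s =
      subst (_∈ beads c) (sym ([m+[1+k]n]∸n≡m+kn r q s))
        (to (runnerCount⇔∈beads q r<s) (<-trans (n<1+n q) (from (runnerCount⇔∈beads (suc q) r<s) x∈)))

  beads-injective : ∀ {b b′} → Profile b s′ c → Profile b′ s′ c′ →
                    beads c ≡ beads c′ → c ≡ c′
  beads-injective {c} {c′} p p′ same =
    part-ext c c′ (trans (Profile.length≡ p) (sym (Profile.length≡ p′))) same-part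
    where
    same-runner : r < s → runnerCount c r ≡ runnerCount c′ r
    same-runner r<s = ≤-antisym
      (≤-from-< λ {q} lt → from (runnerCount⇔∈beads p′ q r<s)
                                (subst (_ ∈_) same (to (runnerCount⇔∈beads p q r<s) lt)))
      (≤-from-< λ {q} lt → from (runnerCount⇔∈beads p q r<s)
                                (subst (_ ∈_) (sym same) (to (runnerCount⇔∈beads p′ q r<s) lt)))
    same-part : ∀ i → part c i ≡ part c′ i
    same-part i with i ≤? s′
    ... | yes i≤s′ =
      subst (λ k → part c k ≡ part c′ k) (m∸[m∸n]≡n i≤s′) (same-runner (s≤s (m∸n≤m s′ i)))
    ... | no  i≰s′ = trans (part-beyond {c} (beyond p)) (sym (part-beyond {c′} (beyond p′)))
      where
      beyond : ∀ {b d} → Profile b s′ d → length d ≤ i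
      beyond p = ≤-trans (≤-reflexive (Profile.length≡ p)) (<⇒≤ (≰⇒> i≰s′))

  module Decode (B : List ℕ) (sparse : Sparse B) (closed : Closed s B)
                (runners-bounded : ∀ {r} → 1 ≤ r → r ≤ s′ → r + m * s ∉ B) where

    OnRunner : ℕ → ℕ → Set
    OnRunner r q = r + q * s ∈ B

    OnRunner-downClosed : ∀ r → DownClosed (OnRunner r)
    OnRunner-downClosed r q on =
      subst (_∈ B) ([m+[1+k]n]∸n≡m+kn r q s) (closed on (≤-trans (m≤m+n s (q * s)) (m≤n+m _ r)))

    runner-zero-empty : ∀ q → ¬ OnRunner 0 q
    runner-zero-empty q on = <-irrefl refl (All.lookup (proj₂ sparse) (Closed-descend closed q on))

    OnRunner-bounded : ∀ q → r < s → OnRunner r q → q < m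
    OnRunner-bounded {zero}  q _   on = ⊥-elim (runner-zero-empty q on)
    OnRunner-bounded {suc r} q r<s on with q <? m
    ... | yes q<m = q<m
    ... | no  q≮m = ⊥-elim (runners-bounded (s≤s z≤n) (≤-pred r<s)
                             (DownClosed-≤ {P = OnRunner (suc r)} (OnRunner-downClosed (suc r))
                                           on (≮⇒≥ q≮m)))

    count : ℕ → ℕ
    count r = leadingCount (λ q → r + q * s ∈? B) m

    count-spec : ∀ q → r < s → OnRunner r q ⇔ q < count r
    count-spec {r} q r<s =
      leadingCount-spec (λ q → r + q * s ∈? B) (OnRunner-downClosed r) (λ q → OnRunner-bounded q r<s) q

    first-bead : r < s → count r ≢ 0 → r ∈ B
    first-bead {r} r<s occupied =
      subst (_∈ B) (+-identityʳ r) (from (count-spec 0 r<s) (n≢0⇒n>0 occupied))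

    profile : List ℕ
    profile = applyUpTo (λ i → count (s′ ∸ i)) s′

    part-profile : i < s′ → part profile i ≡ count (s′ ∸ i)
    part-profile = part-applyUpTo (λ i → count (s′ ∸ i))

    profile-beyond : ¬ i < s′ → part profile i ≡ 0
    profile-beyond i≮s′ =
      part-beyond {profile}
        (≤-trans (≤-reflexive (length-applyUpTo (λ i → count (s′ ∸ i)) s′)) (≮⇒≥ i≮s′))

    runnerCount-profile : r < s → runnerCount profile r ≡ count r
    runnerCount-profile {zero} _ = trans (profile-beyond (<-irrefl refl)) (sym (n≤0⇒n≡0 count0≤0))
      where
      count0≤0 : count 0 ≤ 0
      count0≤0 =
        ≤-from-< (λ {q} lt → ⊥-elim (runner-zero-empty q (from (count-spec q (s≤s z≤n)) lt)))
    runnerCount-profile {suc r} r<s =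
      trans (part-profile (∸-monoʳ-< (s≤s z≤n) (≤-pred r<s))) (cong count (m∸[m∸n]≡n (≤-pred r<s)))

    isProfile : ∀ {b} → (1 ≤ s′ → s′ + b * s ∉ B) → Profile b s′ profile
    isProfile {b} last-runner-bounded = record
      { length≡  = length-applyUpTo _ s′
      ; bounded  = bounded
      ; head≤    = head≤
      ; isolated = isolated
      }
      where
      bounded : ∀ i → part profile i ≤ m
      bounded i with i <? s′
      ... | yes i<s′ = ≤-trans (≤-reflexive (part-profile i<s′)) (leadingCount≤ _ m)
      ... | no  i≮s′ = ≤-trans (≤-reflexive (profile-beyond i≮s′)) z≤n
      head≤ : part profile 0 ≤ b
      head≤ with 0 <? s′
      ... | no  0≮s′ = ≤-trans (≤-reflexive (profile-beyond 0≮s′)) z≤n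
      ... | yes 0<s′ with b <? count s′
      ...   | yes b<count = ⊥-elim (last-runner-bounded 0<s′ (from (count-spec b ≤-refl) b<count))
      ...   | no  b≮count = ≤-trans (≤-reflexive (part-profile 0<s′)) (≮⇒≥ b≮count)
      isolated : ∀ i → part profile i ≡ 0 ⊎ part profile (suc i) ≡ 0
      isolated i with suc i <? s′
      ... | no  1+i≮s′ = inj₂ (profile-beyond 1+i≮s′)
      ... | yes 1+i<s′ with count (s′ ∸ suc i) ≟ 0 | count (s′ ∸ i) ≟ 0
      ...   | yes empty | _         = inj₂ (trans (part-profile 1+i<s′) empty)
      ...   | no  _     | yes empty = inj₁ (trans (part-profile (<-trans (n<1+n i) 1+i<s′)) empty)
      ...   | no  occ   | no  occ′  =
        ⊥-elim (no-successor (proj₁ sparse) (first-bead (s≤s (m∸n≤m s′ (suc i))) occ)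
                 (subst (_∈ B) (+-∸-assoc 1 (<⇒≤ 1+i<s′)) (first-bead (s≤s (m∸n≤m s′ i)) occ′)))

    beads-profile : ∀ {b} → Profile b s′ profile → B ≡ beads profile
    beads-profile p =
      decreasing-ext B (beads profile) (Linked.map Gap⇒> (proj₁ sparse)) (beads-decreasing profile)
                     B⊆ ⊆B
      where
      B⊆ : B ⊆ beads profile
      B⊆ {x} x∈B with position-of x
      ... | position r q r<s =
        to (runnerCount⇔∈beads p q r<s)
           (subst (q <_) (sym (runnerCount-profile r<s)) (to (count-spec q r<s) x∈B))
      ⊆B : beads profile ⊆ B
      ⊆B {x} x∈ with position-of x
      ... | position r q r<s =
        from (count-spec q r<s)
             (subst (q <_) (runnerCount-profile r<s) (from (runnerCount⇔∈beads p q r<s) x∈))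

-- Counting simultaneous cores

module Correspondence
  (s′ m b t : ℕ) (b≤m : b ≤ m) (1≤t : 1 ≤ t)
  (runners-bounded : ∀ {B} → Sparse B → Closed (suc s′) B → Closed t B →
                     ∀ {r} → 1 ≤ r → r ≤ s′ → r + m * suc s′ ∉ B)
  (last-runner-bounded : ∀ {B} → Sparse B → Closed (suc s′) B → Closed t B →
                         1 ≤ s′ → s′ + b * suc s′ ∉ B)
  (beads-below : ∀ {c} → Profiles.Profile m b s′ c →
                 ∀ r q → r < suc s′ → q < Abacus.runnerCount s′ m c r → r + q * suc s′ < t)
  where

  open Profiles m
  open Abacus s′ m

  partitionOf : List ℕ → List ℕ
  partitionOf c = unbeta (beads c)

  beta-partitionOf : Profile b s′ c → beta (partitionOf c) ≡ beads c
  beta-partitionOf p = beta-unbeta _ (beads-sparse p)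

  partitionOf-core : Profile b s′ c → DistinctCore s t (partitionOf c)
  partitionOf-core {c} p = distinct , core (s≤s z≤n) (beads-closed p) , core 1≤t closed-t
    where
    distinct : DistinctPartition (partitionOf c)
    distinct = sparse⇒distinct (beads-sparse p)
    core : ∀ {u} → 1 ≤ u → Closed u (beads c) → IsCore u (partitionOf c)
    core 1≤u closed =
      from (IsCore⇔Closed 1≤u (proj₂ distinct)) (subst (Closed _) (sym (beta-partitionOf p)) closed)
    closed-t : Closed t (beads c)
    closed-t = Closed-below below
      where
      below : ∀ {x} → x ∈ beads c → x < t
      below {x} x∈ with position-of x
      ... | position r q r<s = beads-below p r q r<s (from (runnerCount⇔∈beads p q r<s) x∈)

  partitionOf-injective : c ∈ profiles b s′ → c′ ∈ profiles b s′ →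
                          partitionOf c ≡ partitionOf c′ → c ≡ c′
  partitionOf-injective c∈ c′∈ same = beads-injective p p′
    (trans (sym (beta-partitionOf p)) (trans (cong beta same) (beta-partitionOf p′)))
    where
    p  = ∈profiles⁻ b≤m c∈
    p′ = ∈profiles⁻ b≤m c′∈

  core⇒partitionOf : DistinctCore s t μ → ∃[ c ] c ∈ profiles b s′ × partitionOf c ≡ μ
  core⇒partitionOf {μ} (distinct , s-core , t-core) =
    profile , ∈profiles⁺ p , trans (cong unbeta (sym (beads-profile p))) (unbeta-beta μ)
    where
    sparse   = distinct⇒sparse distinct
    closed-s = to (IsCore⇔Closed (s≤s z≤n) (proj₂ distinct)) s-core
    closed-t = to (IsCore⇔Closed 1≤t (proj₂ distinct)) t-core
    open Decode (beta μ) sparse closed-s (runners-bounded sparse closed-s closed-t)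
    p = isProfile (last-runner-bounded sparse closed-s closed-t)

  distinctCores-count : HasCount (DistinctCore s t) (length (profiles b s′))
  distinctCores-count =
    map partitionOf (profiles b s′) ,
    Unique-map⁺ partitionOf partitionOf-injective (profiles-unique b s′) ,
    (λ μ → sound , complete) ,
    length-map partitionOf (profiles b s′)
    where
    sound : μ ∈ map partitionOf (profiles b s′) → DistinctCore s t μ
    sound μ∈ with c , c∈ , refl ← ∈-map⁻ partitionOf μ∈ = partitionOf-core (∈profiles⁻ b≤m c∈)
    complete : DistinctCore s t μ → μ ∈ map partitionOf (profiles b s′)
    complete core with c , c∈ , refl ← core⇒partitionOf core = ∈-map⁺ partitionOf c∈

distinctCores-plus : ∀ s′ m →
  HasCount (DistinctCore (suc s′) (m * suc s′ + 1)) (length (Profiles.profiles m m s′))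
distinctCores-plus s′ m =
  Correspondence.distinctCores-count s′ m m (m * s + 1) ≤-refl (m≤n+m 1 (m * s))
    runners-bounded (λ sp cs ct 1≤s′ → runners-bounded sp cs ct 1≤s′ ≤-refl) beads-below
  where
  s = suc s′
  runners-bounded : ∀ {B} → Sparse B → Closed s B → Closed (m * s + 1) B →
                    ∀ {r} → 1 ≤ r → r ≤ s′ → r + m * s ∉ B
  runners-bounded {B} (gaps , _) closed-s closed-t {suc r} _ _ x∈B =
    no-successor gaps (subst (_∈ B) down-t (closed-t x∈B t≤x)) (Closed-descend closed-s m x∈B)
    where
    t≤x : m * s + 1 ≤ suc r + m * s
    t≤x = ≤-trans (≤-reflexive (+-comm (m * s) 1)) (s≤s (m≤n+m (m * s) r))
    down-t : suc r + m * s ∸ (m * s + 1) ≡ r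
    down-t = trans (cong (suc r + m * s ∸_) (+-comm (m * s) 1)) (m+n∸n≡m r (m * s))
  beads-below : ∀ {c} → Profiles.Profile m m s′ c →
                ∀ r q → r < s → q < Abacus.runnerCount s′ m c r → r + q * s < m * s + 1
  beads-below p r q r<s q<count =
    ≤-trans (m<n⇒k<o⇒m+kn<on r<s (<-≤-trans q<count (Profiles.Profile.bounded p _))) (m≤m+n (m * s) 1)

-- Here t = suc m′ * s ∸ 1 is s′ + m′ * s by computation.
distinctCores-minus : ∀ s′ m′ → 1 ≤ s′ →
  HasCount (DistinctCore (suc s′) (suc m′ * suc s′ ∸ 1))
           (length (Profiles.profiles (suc m′) m′ s′))
distinctCores-minus s′ m′ 1≤s′ =
  Correspondence.distinctCores-count s′ (suc m′) m′ (s′ + m′ * s)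
    (n≤1+n m′) (≤-trans 1≤s′ (m≤m+n s′ _)) runners-bounded last-runner-bounded beads-below
  where
  s = suc s′
  runners-bounded : ∀ {B} → Sparse B → Closed s B → Closed (s′ + m′ * s) B →
                    ∀ {r} → 1 ≤ r → r ≤ s′ → r + suc m′ * s ∉ B
  runners-bounded {B} (gaps , _) closed-s closed-t {r} _ _ x∈B =
    no-successor gaps (Closed-descend closed-s (suc m′) x∈B) (subst (_∈ B) down-t (closed-t x∈B t≤x))
    where
    t≤x : s′ + m′ * s ≤ r + suc (s′ + m′ * s)
    t≤x = ≤-trans (n≤1+n _) (m≤n+m _ r)
    down-t : r + suc (s′ + m′ * s) ∸ (s′ + m′ * s) ≡ suc r
    down-t = trans (cong (_∸ (s′ + m′ * s)) (+-suc r _)) (m+n∸n≡m (suc r) (s′ + m′ * s))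
  last-runner-bounded : ∀ {B} → Sparse B → Closed s B → Closed (s′ + m′ * s) B →
                        1 ≤ s′ → s′ + m′ * s ∉ B
  last-runner-bounded {B} (_ , positive) _ closed-t _ t∈B =
    <-irrefl refl (All.lookup positive (subst (_∈ B) (n∸n≡0 (s′ + m′ * s)) (closed-t t∈B ≤-refl)))
  beads-below : ∀ {c} → Profiles.Profile (suc m′) m′ s′ c →
                ∀ r q → r < s → q < Abacus.runnerCount s′ (suc m′) c r → r + q * s < s′ + m′ * s
  beads-below {c} p r q r<s q<count with r <? s′
  ... | yes r<s′ = +-mono-<-≤ r<s′ (*-monoˡ-≤ s (≤-pred (<-≤-trans q<count (Profile.bounded p _))))
    where open Profiles (suc m′)
  ... | no  r≮s′ = ≤-trans (m<n⇒k<o⇒m+kn<on r<s q<m′) (m≤n+m _ s′)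
    where
    open Profiles (suc m′)
    last-runner : s′ ∸ r ≡ 0
    last-runner = trans (cong (s′ ∸_) (≤-antisym (≤-pred r<s) (≮⇒≥ r≮s′))) (n∸n≡0 s′)
    q<m′ : q < m′
    q<m′ = <-≤-trans q<count (≤-trans (≤-reflexive (cong (part c) last-runner)) (Profile.head≤ p))

theorem4p3 : (m s : ℕ) → 1 ≤ m → 3 ≤ s →
    Σ ℕ (λ eMinus → Σ ℕ (λ e1 → Σ ℕ (λ e2 →
      HasCount (DistinctCore s (m * s ∸ 1)) eMinus
      × HasCount (DistinctCore (s ∸ 1) (m * (s ∸ 1) + 1)) e1
      × HasCount (DistinctCore (s ∸ 2) (m * (s ∸ 2) + 1)) e2
      × eMinus ≡ e1 + (m ∸ 1) * e2)))
theorem4p3 (suc m′) (suc (suc (suc s₀))) (s≤s z≤n) (s≤s (s≤s (s≤s z≤n))) =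
  length (profiles m′ (suc (suc s₀))) ,
  length (profiles (suc m′) (suc s₀)) ,
  length (profiles (suc m′) s₀) ,
  distinctCores-minus (suc (suc s₀)) m′ (s≤s z≤n) ,
  distinctCores-plus (suc s₀) (suc m′) ,
  distinctCores-plus s₀ (suc m′) ,
  length-profiles-recurrence m′ s₀
  where open Profiles (suc m′)
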